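{- Let $G$ be a connected graph and $H$ a graph with $k\ge1$ connected components $H_1,\dots,H_k$, each of order $m_i\ge 2$. Let $Z$ be a zero forcing set of $G\circ H$. For $a\in V(G)$ and $i\in\{1,\dots,k\}$ let $H_i(a)=\{(a,v):v\in V(H_i)\}$ and $Z_i(a)=Z\cap H_i(a)$. Then $Z_i(a)\neq\emptyset$ for every $a\in V(G)$ and every $i$, and moreover $|Z_i(a)|\ge Z(H_i)$ (the cardinality of a minimum zero forcing set of $H_i$).
   Context: Graphs are finite, simple, undirected, with at least two vertices. Zero forcing: given a set $S$ of initially black vertices (others white), the color-change rule turns a white vertex black if it is the only white neighbor of some black vertex; $S$ is a zero forcing set if eventually all vertices become black; $Z(G)$ is the minimum size of a zero forcing set. The lexicographic product $G\circ H$ has vertex set $V(G)\times V(H)$, with $(a,v)$ adjacent to $(b,w)$ iff $ab\in E(G)$, or $a=b$ and $vw\in E(H)$. -}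

module Defs where

open import Data.Nat using (ℕ; _≤_)
open import Data.Bool using (Bool; true; false; _∨_; _∧_)
open import Data.Fin using (Fin)
import Data.Fin.Properties as FinP
open import Data.List using (List; length; filterᵇ)
open import Data.List.Membership.Propositional using (_∈_)
open import Data.List.Relation.Unary.Unique.Propositional using (Unique)
open import Data.Product using (Σ; _×_; _,_; ∃; proj₁; proj₂)
open import Relation.Binary.PropositionalEquality using (_≡_; _≢_; refl)
open import Relation.Binary.Definitions using (DecidableEquality)
open import Relation.Nullary using (yes; no; does)

record FinGraph : Set₁ where
  field
    V        : Set
    _≟V_     : DecidableEquality V
    elems    : List V
    complete : ∀ v → v ∈ elems
    unique   : Unique elems
    adj      : V → V → Bool
    adj-sym  : ∀ u v → adj u v ≡ adj v u
    adj-irr  : ∀ v → adj v v ≡ false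
open FinGraph public

order : FinGraph → ℕ
order G = length (elems G)

data Walk (G : FinGraph) : V G → V G → Set where
  here : ∀ {u} → Walk G u u
  step : ∀ {u v w} → adj G u v ≡ true → Walk G v w → Walk G u w

Connected : FinGraph → Set
Connected G = ∀ u v → Walk G u v

card : (G : FinGraph) → (V G → Bool) → ℕ
card G S = length (filterᵇ S (elems G))

-- Black adj S v : vertex v is
-- eventually black when starting from the black set S and repeatedly
-- applying the colour-change rule (a black vertex u with v as its only
-- white neighbour forces v).
data Black {X : Set} (ad : X → X → Bool) (S : X → Bool) : X → Set where
  init  : ∀ {v} → S v ≡ true → Black ad S v
  force : ∀ {u v} → Black ad S u → ad u v ≡ true
        → (∀ w → ad u w ≡ true → w ≢ v → Black ad S w)
        → Black ad S v

IsZeroForcingSet : {X : Set} → (X → X → Bool) → (X → Bool) → Set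
IsZeroForcingSet ad S = ∀ v → Black ad S v

IsZeroForcingNumber : FinGraph → ℕ → Set
IsZeroForcingNumber G z =
  (Σ (V G → Bool) λ S → IsZeroForcingSet (adj G) S × card G S ≡ z)
  × (∀ S → IsZeroForcingSet (adj G) S → z ≤ card G S)

-- The graph H given as the disjoint union of its components Hs i, i : Fin k.
HVert : {k : ℕ} → (Fin k → FinGraph) → Set
HVert {k} Hs = Σ (Fin k) (λ i → V (Hs i))

HAdj : {k : ℕ} → (Hs : Fin k → FinGraph) → HVert Hs → HVert Hs → Bool
HAdj Hs (i , v) (j , w) with i FinP.≟ j
... | yes refl = adj (Hs i) v w
... | no _     = false

LexAdj : (G : FinGraph) {k : ℕ} (Hs : Fin k → FinGraph)
       → V G × HVert Hs → V G × HVert Hs → Bool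
LexAdj G Hs (a , x) (b , y) = adj G a b ∨ (does ((_≟V_ G) a b) ∧ HAdj Hs x y)

-- Restricting a zero forcing set Z of G ∘ H to a fibre H_j(b) gives a zero
-- forcing set of H_j.  A force into H_j(b) comes either from a vertex over a
-- G-neighbour of b, which is adjacent to the whole fibre, so that every other
-- vertex of the fibre is already black and the target is forced inside H_j by
-- any of its neighbours (H_j is connected with at least two vertices); or from
-- inside the fibre, where the neighbourhood in G ∘ H restricts to that in H_j.
-- Both conclusions follow: a zero forcing set of a graph with a vertex is
-- nonempty, and it has at least Z(H_i) elements.
module Submission where

open import Defs
open import Data.Nat using (ℕ; _≤_; s≤s)
open import Data.Bool using (Bool; true; false)
open import Data.Fin using (Fin)
import Data.Fin.Properties as FinP
open import Data.Product using (Σ; _×_; _,_; ∃)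
open import Data.Empty using (⊥-elim)
open import Data.List using (_∷_)
open import Data.List.Relation.Unary.All using (_∷_)
open import Data.List.Relation.Unary.AllPairs using (_∷_)
open import Relation.Binary.PropositionalEquality using (_≡_; _≢_; refl; sym; trans)
open import Relation.Nullary using (yes; no)

someVertex : (H : FinGraph) → 2 ≤ order H → V H
someVertex H le with elems H | le
... | e ∷ _ | s≤s _ = e

otherVertex : (H : FinGraph) → 2 ≤ order H → (v : V H) → Σ (V H) (λ w → w ≢ v)
otherVertex H le v with elems H | unique H | le
... | e₁ ∷ e₂ ∷ _ | (e₁≢e₂ ∷ _) ∷ _ | s≤s (s≤s _) with (_≟V_ H) e₁ v
...   | no e₁≢v   = e₁ , e₁≢v
...   | yes refl  = e₂ , λ e₂≡v → e₁≢e₂ (sym e₂≡v)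

walk-firstStep : (H : FinGraph) {v w : V H} → Walk H v w → w ≢ v
               → Σ (V H) (λ u → adj H v u ≡ true)
walk-firstStep H here        w≢v = ⊥-elim (w≢v refl)
walk-firstStep H (step e _) _   = _ , e

connected⇒neighbour : (H : FinGraph) → Connected H → 2 ≤ order H
                    → (v : V H) → Σ (V H) (λ u → adj H u v ≡ true)
connected⇒neighbour H conn le v with otherVertex H le v
... | w , w≢v with walk-firstStep H (conn v w) w≢v
... | u , vu = u , trans (adj-sym H u v) vu

adj⇒≢ : (H : FinGraph) {u v : V H} → adj H u v ≡ true → u ≢ v
adj⇒≢ H {u} uv refl with trans (sym uv) (adj-irr H u)
... | ()

black-if-othersBlack : (H : FinGraph) (S : V H → Bool) {u v : V H}
                     → adj H u v ≡ true
                     → (∀ x → x ≢ v → Black (adj H) S x)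
                     → Black (adj H) S v
black-if-othersBlack H S uv othersBlack =
  force (othersBlack _ (adj⇒≢ H uv)) uv (λ x _ x≢v → othersBlack x x≢v)

black⇒initialBlack : ∀ {X : Set} {ad : X → X → Bool} {S : X → Bool} {v : X}
                   → Black ad S v → ∃ λ u → S u ≡ true
black⇒initialBlack (init Su)      = _ , Su
black⇒initialBlack (force bu _ _) = black⇒initialBlack bu

zeroForcingSet-nonempty : ∀ {X : Set} {ad : X → X → Bool} {S : X → Bool}
                        → IsZeroForcingSet ad S → X → ∃ λ u → S u ≡ true
zeroForcingSet-nonempty zf x = black⇒initialBlack (zf x)

module _ (G : FinGraph) {k : ℕ} (Hs : Fin k → FinGraph) where

  fibre : (V G × HVert Hs → Bool) → V G → (i : Fin k) → V (Hs i) → Bool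
  fibre Z a i v = Z (a , (i , v))

  data LexEdge : V G × HVert Hs → V G × HVert Hs → Set where
    across : ∀ {c b p q} → adj G c b ≡ true → LexEdge (c , p) (b , q)
    within : ∀ {b j y x} → adj (Hs j) y x ≡ true → LexEdge (b , (j , y)) (b , (j , x))

  LexAdj-across : ∀ {c b p q} → adj G c b ≡ true → LexAdj G Hs (c , p) (b , q) ≡ true
  LexAdj-across cb rewrite cb = refl

  LexAdj-within : ∀ {b j y x} → adj (Hs j) y x ≡ true
                → LexAdj G Hs (b , (j , y)) (b , (j , x)) ≡ true
  LexAdj-within {b} {j} yx rewrite adj-irr G b with (_≟V_ G) b b
  ... | no b≢b = ⊥-elim (b≢b refl)
  ... | yes refl with j FinP.≟ j
  ...   | no j≢j = ⊥-elim (j≢j refl)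
  ...   | yes refl = yx

  LexAdj⇒LexEdge : ∀ {p q} → LexAdj G Hs p q ≡ true → LexEdge p q
  LexAdj⇒LexEdge {c , (l , y)} {b , (j , x)} e
    with adj G c b in cb | (_≟V_ G) c b | l FinP.≟ j
  ... | true  | _        | _        = across cb
  ... | false | yes refl | yes refl = within e
  LexAdj⇒LexEdge () | false | no _     | _
  LexAdj⇒LexEdge () | false | yes refl | no _

  module _ (conn : ∀ i → Connected (Hs i)) (ord : ∀ i → 2 ≤ order (Hs i))
           (Z : V G × HVert Hs → Bool) where

    black-restrict : ∀ {b j v} → Black (LexAdj G Hs) Z (b , (j , v))
                   → Black (adj (Hs j)) (fibre Z b j) v
    black-restrict (init Zv) = init Zv
    black-restrict {b} {j} {v} (force {c , (l , y)} bu e others)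
      with LexAdj⇒LexEdge {c , (l , y)} {b , (j , v)} e
    ... | across cb =
      let _ , uv = connected⇒neighbour (Hs j) (conn j) (ord j) v
      in black-if-othersBlack (Hs j) (fibre Z b j) uv
           (λ x x≢v → black-restrict
              (others (b , (j , x)) (LexAdj-across {p = l , y} cb) λ { refl → x≢v refl }))
    ... | within yv =
      force (black-restrict bu) yv
        (λ x yx x≢v → black-restrict
           (others (b , (j , x)) (LexAdj-within yx) λ { refl → x≢v refl }))

    fibre-isZeroForcingSet : IsZeroForcingSet (LexAdj G Hs) Z
                           → ∀ a i → IsZeroForcingSet (adj (Hs i)) (fibre Z a i)
    fibre-isZeroForcingSet zf a i v = black-restrict (zf (a , (i , v)))

mainTheorem7 : (G : FinGraph) → 2 ≤ order G → Connected G
    → (k : ℕ) → 1 ≤ k → (Hs : Fin k → FinGraph)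
    → (∀ i → Connected (Hs i)) → (∀ i → 2 ≤ order (Hs i))
    → (Z : V G × HVert Hs → Bool) → IsZeroForcingSet (LexAdj G Hs) Z
    → ∀ (a : V G) (i : Fin k)
    → Σ (V (Hs i)) (λ v → Z (a , (i , v)) ≡ true)
      × (∀ z → IsZeroForcingNumber (Hs i) z → z ≤ card (Hs i) (λ v → Z (a , (i , v))))
mainTheorem7 G _ _ k _ Hs conn ord Z zf a i =
  zeroForcingSet-nonempty restricted (someVertex (Hs i) (ord i)) ,
  λ { z (_ , minimal) → minimal _ restricted }
  where
  restricted : IsZeroForcingSet (adj (Hs i)) (fibre G Hs Z a i)
  restricted = fibre-isZeroForcingSet G Hs conn ord Z zf a i
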